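{- Let $r\ge4$, $s\ge3$, $0\le t\le s-1$, $G=T(r,s,t)$, and let $\mathcal L$ be a list assignment on $G$ with every list of size $5$, satisfying criteria (i)–(iv). Let $(i,j+1)$ and $(i,j)$ have distinct lists $L_1$ and $L_2$ respectively, and suppose neither vertex belongs to an isolated component (of its list-class). Then one of the following holds: (I) the vertices $(i,k),(i+1,k),(i+2,k)$ have list $L_1$ for $k=j+2,j+1$ and list $L_2$ for $k=j,j-1$; (II) the vertices $(i,k),(i+1,k),(i+2,k-1)$ have list $L_1$ for $k=j+2,j+1$ and list $L_2$ for $k=j,j-1$; (III) the vertices $(i,k),(i+1,k-1),(i+2,k-1)$ have list $L_1$ for $k=j+2,j+1$ and list $L_2$ for $k=j,j-1$; (IV) the vertices $(i,k),(i+1,k-1),(i+2,k-2)$ have list $L_1$ for $k=j+2,j+1$ and list $L_2$ for $k=j,j-1$; (V) the vertices $(i,k),(i+1,k),(i+2,k)$ have list $L_1$ for $k=j+2,j+1$, the vertices $(i,k),(i+1,k),(i+2,k-1)$ have list $L_2$ for $k=j,j-1$, and $(i+2,j)$ forms an isolated component of some list-class $G[L_3]$ with $L_3\neq L_1$, $L_3\neq L_2$; (VI) the vertices $(i,k),(i+1,k-1),(i+2,k-1)$ have list $L_1$ for $k=j+2,j+1$, the vertices $(i,k),(i+1,k-1),(i+2,k-2)$ have list $L_2$ for $k=j,j-1$, and $(i+2,j-1)$ forms an isolated component of some list-class $G[L_3]$ with $L_3\neq L_1$, $L_3\neq L_2$; (VII) the vertices $(i,k),(i+1,k),(i+2,k-1)$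 have list $L_1$ for $k=j+2,j+1$, the vertices $(i,k),(i+1,k-1),(i+2,k-1)$ have list $L_2$ for $k=j,j-1$, and $(i+1,j)$ forms an isolated component of some list-class $G[L_3]$ with $L_3\neq L_1$, $L_3\neq L_2$.
   Context: $T(r,s,t)$: vertex set $\{(i,j):1\le i\le r,1\le j\le s\}$. Index convention: for arbitrary integers $i,j$, the symbol $(i,j)$ denotes the vertex $(i',j')$ where $i=i'+mr$ with $1\le i'\le r$ and $j'\equiv j-mt\pmod s$. Every vertex $(i,j)$ is adjacent exactly to $(i,j\pm1)$ (vertical neighbors), $(i-1,j),(i-1,j+1)$ (left neighbors) and $(i+1,j),(i+1,j-1)$ (right neighbors); column $C_i=\{(i,j):1\le j\le s\}$. $\mathcal L$ gives each vertex a list; write $L(i,j)$ for the list of $(i,j)$. For a list $L$, the list-class $G[L]$ is the subgraph induced on the vertices whose list equals $L$; a connected component of $G[L]$ is isolated if it has one vertex. Criteria: (i) not all lists are identical, and for every $(i,j)$, $L(i,j)\subseteq L(i-1,j)\cup L(i-1,j+1)$ and $L(i,j)\subseteq L(i+1,j)\cup L(i+1,j-1)$. (ii) Whenever $L(i,j)\neq L(i,j-1)$, one of: (a) $L(i,j)=L(i-1,j+1)$ and $L(i,j-1)=L(i-1,j-1)$; (b) $L(i,j)=L(i-1,j+1)=L(i-1,j)$ and $L(i,j-1)\neq L(i-1,j-1)$; (c) $L(i,j)\neq L(i-1,j+1)$ and $L(i,j-1)=L(i-1,j)=L(i-1,j-1)$ holds; and also one of: (a') $L(i,j)=L(i+1,j)$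 and $L(i,j-1)=L(i+1,j-2)$; (b') $L(i,j-1)=L(i+1,j-2)=L(i+1,j-1)$ and $L(i,j)\neq L(i+1,j)$; (c') $L(i,j-1)\neq L(i+1,j-2)$ and $L(i,j)=L(i+1,j-1)=L(i+1,j)$ holds. (iii) Whenever $u,v$ are adjacent vertices in distinct columns with $L(u)=L(v)$, some vertex $w$ adjacent to both has $L(w)=L(u)$. (iv) Whenever $u,v,w$ are pairwise adjacent with identical lists and $v,w$ lie in the same column, at least one vertical neighbor of $u$ has list equal to $L(u)$. -}

module Defs where

open import Data.Nat as ℕ using (ℕ; NonZero)
open import Data.Integer as ℤ using (ℤ; +_; _-_; _+_; _*_; _%ℕ_; _/ℕ_)
open import Data.Integer.DivMod using (n%ℕd<d)
open import Data.Fin using (Fin; fromℕ<)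
open import Data.Product using (Σ; _×_; _,_; proj₁; ∃-syntax)
open import Data.Sum using (_⊎_)
open import Data.List using (List; length)
open import Data.List.Membership.Propositional using (_∈_)
open import Data.List.Relation.Unary.Unique.Propositional using (Unique)
open import Relation.Binary.PropositionalEquality using (_≡_; _≢_)
open import Relation.Nullary using (¬_)

-- Colour lists: finite sets of colours (natural numbers), represented
-- by duplicate-free lists; two lists are "equal" when equal as sets.

_≈L_ : List ℕ → List ℕ → Set
A ≈L B = ∀ c → (c ∈ A → c ∈ B) × (c ∈ B → c ∈ A)

Size5 : List ℕ → Set
Size5 A = Unique A × length A ≡ 5

_⊆_∪_ : List ℕ → List ℕ → List ℕ → Set
A ⊆ B ∪ C = ∀ c → c ∈ A → c ∈ B ⊎ c ∈ C

-- The graph T(r,s,t).  Vertex (i,j) with 1 ≤ i ≤ r, 1 ≤ j ≤ s is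
-- represented 0-based by (i-1, j-1) : Fin r × Fin s.

Vtx : ℕ → ℕ → Set
Vtx r s = Fin r × Fin s

module Torus (r s t : ℕ) {{_ : NonZero r}} {{_ : NonZero s}} where

  -- Index convention: for arbitrary integers i, j, (i,j) denotes
  -- (i',j') with i = i' + m r, 1 ≤ i' ≤ r, j' ≡ j - m t (mod s).
  pos : ℤ → ℤ → Vtx r s
  pos i j = fromℕ< (n%ℕd<d (i - + 1) r) , fromℕ< (n%ℕd<d (j - + 1 - m * + t) s)
    where
    m : ℤ
    m = (i - + 1) /ℕ r

  Nbr : ℤ → ℤ → Vtx r s → Set
  Nbr i j v = v ≡ pos i (j + + 1) ⊎ v ≡ pos i (j - + 1)
            ⊎ v ≡ pos (i - + 1) j ⊎ v ≡ pos (i - + 1) (j + + 1)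
            ⊎ v ≡ pos (i + + 1) j ⊎ v ≡ pos (i + + 1) (j - + 1)

  Adj : Vtx r s → Vtx r s → Set
  Adj u v = Σ ℤ λ i → Σ ℤ λ j → pos i j ≡ u × Nbr i j v

  VertNbr : Vtx r s → Vtx r s → Set
  VertNbr u v = Σ ℤ λ i → Σ ℤ λ j → pos i j ≡ u × (v ≡ pos i (j + + 1) ⊎ v ≡ pos i (j - + 1))

  module _ (L : Vtx r s → List ℕ) where

    Lz : ℤ → ℤ → List ℕ
    Lz i j = L (pos i j)

    -- v forms an isolated (one-vertex) component of its list-class G[L(v)]
    Isolated : Vtx r s → Set
    Isolated v = ∀ w → Adj v w → ¬ (L w ≈L L v)

    CritI : Set
    CritI = (Σ (Vtx r s) λ u → Σ (Vtx r s) λ v → ¬ (L u ≈L L v))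
          × (∀ i j → (Lz i j ⊆ Lz (i - + 1) j ∪ Lz (i - + 1) (j + + 1))
                   × (Lz i j ⊆ Lz (i + + 1) j ∪ Lz (i + + 1) (j - + 1)))

    CritII : Set
    CritII = ∀ i j → ¬ (Lz i j ≈L Lz i (j - + 1)) →
      ((Lz i j ≈L Lz (i - + 1) (j + + 1) × Lz i (j - + 1) ≈L Lz (i - + 1) (j - + 1))
       ⊎ (Lz i j ≈L Lz (i - + 1) (j + + 1) × Lz (i - + 1) (j + + 1) ≈L Lz (i - + 1) j
           × ¬ (Lz i (j - + 1) ≈L Lz (i - + 1) (j - + 1)))
       ⊎ (¬ (Lz i j ≈L Lz (i - + 1) (j + + 1)) × Lz i (j - + 1) ≈L Lz (i - + 1) j
           × Lz (i - + 1) j ≈L Lz (i - + 1) (j - + 1)))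
      ×
      ((Lz i j ≈L Lz (i + + 1) j × Lz i (j - + 1) ≈L Lz (i + + 1) (j - + 2))
       ⊎ (Lz i (j - + 1) ≈L Lz (i + + 1) (j - + 2) × Lz (i + + 1) (j - + 2) ≈L Lz (i + + 1) (j - + 1)
           × ¬ (Lz i j ≈L Lz (i + + 1) j))
       ⊎ (¬ (Lz i (j - + 1) ≈L Lz (i + + 1) (j - + 2)) × Lz i j ≈L Lz (i + + 1) (j - + 1)
           × Lz (i + + 1) (j - + 1) ≈L Lz (i + + 1) j))

    CritIII : Set
    CritIII = ∀ u v → Adj u v → proj₁ u ≢ proj₁ v → L u ≈L L v →
      Σ (Vtx r s) λ w → Adj u w × Adj v w × L w ≈L L u

    CritIV : Set
    CritIV = ∀ u v w → Adj u v → Adj u w → Adj v w →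
      L v ≈L L u → L w ≈L L u → proj₁ v ≡ proj₁ w →
      Σ (Vtx r s) λ x → VertNbr u x × L x ≈L L u

    Criteria : Set
    Criteria = CritI × CritII × CritIII × CritIV

    module _ (i j : ℤ) where
      L₁ L₂ : List ℕ
      L₁ = Lz i (j + + 1)
      L₂ = Lz i j

      Trip : ℤ → ℤ → ℤ → List ℕ → Set
      Trip a b k M = Lz i k ≈L M × Lz (i + + 1) (k - a) ≈L M × Lz (i + + 2) (k - b) ≈L M

      Top : ℤ → ℤ → Set
      Top a b = Trip a b (j + + 2) L₁ × Trip a b (j + + 1) L₁

      Bot : ℤ → ℤ → Set
      Bot a b = Trip a b j L₂ × Trip a b (j - + 1) L₂

      IsoNew : Vtx r s → Set
      IsoNew v = Isolated v × ¬ (L v ≈L L₁) × ¬ (L v ≈L L₂)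

      Conclusion : Set
      Conclusion =
          (Top (+ 0) (+ 0) × Bot (+ 0) (+ 0))
        ⊎ (Top (+ 0) (+ 1) × Bot (+ 0) (+ 1))
        ⊎ (Top (+ 1) (+ 1) × Bot (+ 1) (+ 1))
        ⊎ (Top (+ 1) (+ 2) × Bot (+ 1) (+ 2))
        ⊎ (Top (+ 0) (+ 0) × Bot (+ 0) (+ 1) × IsoNew (pos (i + + 2) j))
        ⊎ (Top (+ 1) (+ 1) × Bot (+ 1) (+ 2) × IsoNew (pos (i + + 2) (j - + 1)))
        ⊎ (Top (+ 0) (+ 1) × Bot (+ 1) (+ 1) × IsoNew (pos (i + + 1) j))

-- A vertex whose two vertical neighbours both carry other
-- lists is isolated: a same-list neighbour in a side column would, by (iii),
-- share a same-list neighbour with it, necessarily in the same side column,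
-- and (iv) would then give a vertical neighbour with the same list.  Hence
-- non-isolation propagates each list one more cell vertically, and in the
-- column to the right criterion (i) with equal list sizes forces the lists
-- just above and below the change.  The list at the change then either
-- continues the upper list, continues the lower one, or is an isolated new
-- list; in the last case the right half of (ii) forces the following column
-- one row lower.  Two such column steps give the seven shapes (I)-(VII).

module Submission where

open import Defs
open import Data.Nat as ℕ using (ℕ; NonZero; _≤_; _<_; z≤n; s≤s)
import Data.Nat.Properties as ℕP
open import Data.Integer using (ℤ; +_; 0ℤ; _⊖_; _+_; _-_; _*_; -_; ∣_∣; _%ℕ_; _/ℕ_)
import Data.Integer.Properties as ℤP
open import Data.Integer.DivMod using (a≡a%ℕn+[a/ℕn]*n; n%ℕd<d)
open import Data.Integer.Tactic.RingSolver using (solve; solve-∀)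
open import Algebra.Properties.AbelianGroup ℤP.+-0-abelianGroup using (∙-cancelˡ; ∙-cancelʳ)
import Data.Fin.Properties as FinP
open import Data.List using (List; []; _∷_; length)
open import Data.List.Properties using (length-removeAt′)
open import Data.List.Membership.Propositional using (_∈_)
open import Data.List.Membership.DecPropositional ℕP._≟_ using (_∈?_)
open import Data.List.Relation.Unary.Any using (here; there; index; _─_)
import Data.List.Relation.Unary.All as All
open import Data.List.Relation.Unary.AllPairs using (_∷_)
open import Data.List.Relation.Binary.Subset.Propositional using (_⊆_)
open import Data.List.Relation.Binary.Subset.DecPropositional ℕP._≟_ using (_⊆?_)
open import Data.List.Relation.Unary.Unique.Propositional using (Unique)
open import Data.Product using (Σ; ∃-syntax; _×_; _,_; proj₁; proj₂)
open import Data.Sum using (_⊎_; inj₁; inj₂)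
import Data.Sum as Sum
open import Data.Empty using (⊥; ⊥-elim)
open import Relation.Nullary using (¬_; Dec; yes; no; contradiction)
open import Relation.Nullary.Decidable as Dec using (_×-dec_)
open import Relation.Binary.PropositionalEquality
open import Function using (_∘_)
open import Data.Unit using (tt)
open import Agda.Builtin.FromNat using (fromNat)
open import Agda.Builtin.FromNeg using (fromNeg)
import Data.Nat.Literals as ℕLiterals
import Data.Integer.Literals as ℤLiterals

instance
  _ = ℕLiterals.number
  _ = ℤLiterals.number
  _ = ℤLiterals.negative
  _ = tt

-- Colour lists as sets

≈-refl : ∀ {A} → A ≈L A
≈-refl c = (λ m → m) , (λ m → m)

≈-reflexive : ∀ {A B} → A ≡ B → A ≈L B
≈-reflexive refl = ≈-refl

≈-sym : ∀ {A B} → A ≈L B → B ≈L A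
≈-sym A≈B c = proj₂ (A≈B c) , proj₁ (A≈B c)

≈-trans : ∀ {A B C} → A ≈L B → B ≈L C → A ≈L C
≈-trans A≈B B≈C c = (λ m → proj₁ (B≈C c) (proj₁ (A≈B c) m)) ,
                     (λ m → proj₂ (A≈B c) (proj₂ (B≈C c) m))

_≈?_ : ∀ A B → Dec (A ≈L B)
A ≈? B = Dec.map′ (λ (⊆⊇ : A ⊆ B × B ⊆ A) c → (λ m → proj₁ ⊆⊇ m) , (λ m → proj₂ ⊆⊇ m))
                  (λ A≈B → proj₁ (A≈B _) , proj₂ (A≈B _))
                  ((A ⊆? B) ×-dec (B ⊆? A))

∈-─ : ∀ {x y} (xs : List ℕ) (y∈xs : y ∈ xs) → x ∈ xs → x ≢ y → x ∈ (xs ─ y∈xs)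
∈-─ (_ ∷ _)  (here refl)  (here refl) x≢y = contradiction refl x≢y
∈-─ (_ ∷ _)  (here _)     (there x∈)  _   = x∈
∈-─ (_ ∷ _)  (there _)    (here x≡)   _   = here x≡
∈-─ (_ ∷ xs) (there y∈xs) (there x∈)  x≢y = there (∈-─ xs y∈xs x∈ x≢y)

Unique-⊆⇒length≤ : ∀ {A B : List ℕ} → Unique A → A ⊆ B → length A ≤ length B
Unique-⊆⇒length≤ {[]}    _                 _   = z≤n
Unique-⊆⇒length≤ {a ∷ A} {B} (a≢A ∷ uniqueA) A⊆B = ℕP.≤-trans
  (s≤s (Unique-⊆⇒length≤ uniqueA A⊆B─a)) (ℕP.≤-reflexive (sym (length-removeAt′ B (index a∈B))))
  where
  a∈B = A⊆B (here refl)
  A⊆B─a : A ⊆ (B ─ a∈B)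
  A⊆B─a x∈A = ∈-─ B a∈B (A⊆B (there x∈A)) (λ x≡a → All.lookup a≢A x∈A (sym x≡a))

Unique-⊆-length≥⇒⊇ : ∀ {A B : List ℕ} → Unique A → length B ≤ length A → A ⊆ B → B ⊆ A
Unique-⊆-length≥⇒⊇ {A} {B} uniqueA ∣B∣≤∣A∣ A⊆B {c} c∈B with c ∈? A
... | yes c∈A = c∈A
... | no  c∉A =
  contradiction (ℕP.≤-trans ∣B∣≤∣A∣ (Unique-⊆⇒length≤ uniqueA A⊆B─c)) (ℕP.<⇒≱ ∣B─c∣<∣B∣)
  where
  A⊆B─c : A ⊆ (B ─ c∈B)
  A⊆B─c x∈A = ∈-─ B c∈B (A⊆B x∈A) (λ x≡c → c∉A (subst (_∈ A) x≡c x∈A))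
  ∣B─c∣<∣B∣ : length (B ─ c∈B) < length B
  ∣B─c∣<∣B∣ = ℕP.≤-reflexive (sym (length-removeAt′ B (index c∈B)))

Size5-⊆⇒≈ : ∀ {A B} → Size5 A → Size5 B → A ⊆ B → A ≈L B
Size5-⊆⇒≈ (uniqueA , ∣A∣≡5) (_ , ∣B∣≡5) A⊆B c =
  A⊆B , Unique-⊆-length≥⇒⊇ uniqueA (ℕP.≤-reflexive (trans ∣B∣≡5 (sym ∣A∣≡5))) A⊆B

⊆-∪-≈⇒⊆ : ∀ {A B C M} → A ⊆ B ∪ C → B ≈L M → C ≈L M → A ⊆ M
⊆-∪-≈⇒⊆ A⊆B∪C B≈M C≈M {c} c∈A with A⊆B∪C c c∈A
... | inj₁ c∈B = proj₁ (B≈M c) c∈B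
... | inj₂ c∈C = proj₁ (C≈M c) c∈C

-- Euclidean division by a natural number

private
  a+qd≡b+q′d⇒b-a≡[q-q′]d : ∀ a b q q′ d → a + q * d ≡ b + q′ * d → b - a ≡ (q - q′) * d
  a+qd≡b+q′d⇒b-a≡[q-q′]d a b q q′ d eq = begin
    b - a                      ≡⟨ solve (a ∷ b ∷ q′ ∷ d ∷ []) ⟩
    (b + q′ * d) - a - q′ * d  ≡⟨ cong (λ z → z - a - q′ * d) (sym eq) ⟩
    (a + q * d) - a - q′ * d   ≡⟨ solve (a ∷ q ∷ q′ ∷ d ∷ []) ⟩
    (q - q′) * d               ∎
    where open ≡-Reasoning

  [a+c]-e≡[a-e]+c : ∀ a c e → (a + c) - e ≡ (a - e) + c
  [a+c]-e≡[a-e]+c = solve-∀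

  [a+c]-c≡a : ∀ a c → (a + c) - c ≡ a
  [a+c]-c≡a = solve-∀

  [a-c]+c≡a : ∀ a c → (a - c) + c ≡ a
  [a-c]+c≡a = solve-∀

module _ (d : ℕ) .{{_ : NonZero d}} where

  small-multiple≡0 : ∀ {m} z → m < d → + m ≡ z * + d → z ≡ 0ℤ
  small-multiple≡0 z m<d m≡zd =
    ℤP.∣i∣≡0⇒i≡0 (ℕP.n<1⇒n≡0 (ℕP.*-cancelʳ-< d ∣ z ∣ 1 ∣z∣d<d))
    where
    ∣z∣d<d : ∣ z ∣ ℕ.* d < 1 ℕ.* d
    ∣z∣d<d = subst₂ _<_ (trans (cong ∣_∣ m≡zd) (ℤP.abs-* z (+ d))) (sym (ℕP.*-identityˡ d)) m<d

  quotient-unique : ∀ {ρ ρ′} q q′ → ρ ≤ ρ′ → ρ′ < d → + ρ + q * + d ≡ + ρ′ + q′ * + d → q ≡ q′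
  quotient-unique {ρ} {ρ′} q q′ ρ≤ρ′ ρ′<d eq =
    ℤP.i-j≡0⇒i≡j q q′ (small-multiple≡0 (q - q′) (ℕP.≤-<-trans (ℕP.m∸n≤m ρ′ ρ) ρ′<d) (begin
      + (ρ′ ℕ.∸ ρ)        ≡⟨ sym (ℤP.⊖-≥ ρ≤ρ′) ⟩
      ρ′ ⊖ ρ            ≡⟨ sym (ℤP.m-n≡m⊖n ρ′ ρ) ⟩
      + ρ′ - + ρ          ≡⟨ a+qd≡b+q′d⇒b-a≡[q-q′]d (+ ρ) (+ ρ′) q q′ (+ d) eq ⟩
      (q - q′) * + d      ∎))
    where open ≡-Reasoning

  divMod-unique : ∀ {x ρ} q → ρ < d → x ≡ + ρ + q * + d → x %ℕ d ≡ ρ × x /ℕ d ≡ q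
  divMod-unique {x} {ρ} q ρ<d x≡ = ρ′≡ρ , q′≡q
    where
    ρ′ = x %ℕ d
    q′ = x /ℕ d
    eq : + ρ′ + q′ * + d ≡ + ρ + q * + d
    eq = trans (sym (a≡a%ℕn+[a/ℕn]*n x d)) x≡
    q′≡q : q′ ≡ q
    q′≡q with ℕP.≤-total ρ′ ρ
    ... | inj₁ ρ′≤ρ = quotient-unique q′ q ρ′≤ρ ρ<d eq
    ... | inj₂ ρ≤ρ′ = sym (quotient-unique q q′ ρ≤ρ′ (n%ℕd<d x d) (sym eq))
    ρ′≡ρ : ρ′ ≡ ρ
    ρ′≡ρ = ℤP.+-injective (∙-cancelʳ (q * + d) (+ ρ′) (+ ρ)
                                      (subst (λ z → + ρ′ + z * + d ≡ + ρ + q * + d) q′≡q eq))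

  divMod-+-multiple : ∀ x k → (x + k * + d) %ℕ d ≡ x %ℕ d × (x + k * + d) /ℕ d ≡ x /ℕ d + k
  divMod-+-multiple x k = divMod-unique (x /ℕ d + k) (n%ℕd<d x d) (begin
    x + k * + d                                ≡⟨ cong (_+ k * + d) (a≡a%ℕn+[a/ℕn]*n x d) ⟩
    + (x %ℕ d) + (x /ℕ d) * + d + k * + d      ≡⟨ regroup (+ (x %ℕ d)) (x /ℕ d) k (+ d) ⟩
    + (x %ℕ d) + (x /ℕ d + k) * + d            ∎)
    where
    open ≡-Reasoning
    regroup : ∀ ρ q k d → ρ + q * d + k * d ≡ ρ + (q + k) * d
    regroup = solve-∀

  x%d≡y%d⇒y≡x+[y/d-x/d]*d : ∀ x y → x %ℕ d ≡ y %ℕ d → y ≡ x + (y /ℕ d - x /ℕ d) * + d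
  x%d≡y%d⇒y≡x+[y/d-x/d]*d x y eq = begin
    y                                 ≡⟨ a≡a%ℕn+[a/ℕn]*n y d ⟩
    + (y %ℕ d) + (y /ℕ d) * + d       ≡⟨ cong (λ ρ → + ρ + (y /ℕ d) * + d) (sym eq) ⟩
    + (x %ℕ d) + (y /ℕ d) * + d       ≡⟨ regroup (+ (x %ℕ d)) (x /ℕ d) (y /ℕ d) (+ d) ⟩
    + (x %ℕ d) + (x /ℕ d) * + d + k   ≡⟨ cong (_+ k) (sym (a≡a%ℕn+[a/ℕn]*n x d)) ⟩
    x + k                             ∎
    where
    open ≡-Reasoning
    k = (y /ℕ d - x /ℕ d) * + d
    regroup : ∀ ρ q q′ d → ρ + q′ * d ≡ ρ + q * d + (q′ - q) * d
    regroup = solve-∀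

-- A frame is a choice of local coordinates, at F x y = pos (col x) (row y).
-- Frames compose under shift, so for literal offsets a vertex of a shifted
-- frame is definitionally the corresponding vertex of the original one
-- (at (shift F 1 -1) 0 2 and at F 1 1 are the same term).
record Frame : Set where
  field
    col row : ℤ → ℤ
    col-+ : ∀ x c → col (x + c) ≡ col x + c
    row-+ : ∀ y c → row (y + c) ≡ row y + c

frame : ℤ → ℤ → Frame
frame i j = record
  { col = λ x → i + x
  ; row = λ y → j + y
  ; col-+ = λ x c → sym (ℤP.+-assoc i x c)
  ; row-+ = λ y c → sym (ℤP.+-assoc j y c)
  }

shift : Frame → ℤ → ℤ → Frame
shift F p q = record
  { col = λ x → col (p + x)
  ; row = λ y → row (q + y)
  ; col-+ = λ x c → trans (cong col (sym (ℤP.+-assoc p x c))) (col-+ (p + x) c)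
  ; row-+ = λ y c → trans (cong row (sym (ℤP.+-assoc q y c))) (row-+ (q + y) c)
  }
  where open Frame F

data Side : Set where
  left right : Side

beside : Side → ℤ → ℤ
beside left  x = x - 1
beside right x = x + 1

module Geometry (r s t : ℕ) {{_ : NonZero r}} {{_ : NonZero s}} where
  open Torus r s t

  -- the m of the index convention (i = i′ + m r) that enters the row of pos
  winding : ℤ → ℤ
  winding a = (a - 1) /ℕ r

  pos-periodic : ∀ a b m n → pos (a + m * + r) (b + m * + t + n * + s) ≡ pos a b
  pos-periodic a b m n = cong₂ _,_ (FinP.fromℕ<-cong _ _ column≡ _ _) (FinP.fromℕ<-cong _ _ row≡ _ _)
    where
    lower : (a + m * + r) - 1 ≡ (a - 1) + m * + r
    lower = [a+c]-e≡[a-e]+c a (m * + r) 1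
    column≡ : ((a + m * + r) - 1) %ℕ r ≡ (a - 1) %ℕ r
    column≡ = trans (cong (_%ℕ r) lower) (proj₁ (divMod-+-multiple r (a - 1) m))
    winding≡ : winding (a + m * + r) ≡ winding a + m
    winding≡ = trans (cong (_/ℕ r) lower) (proj₂ (divMod-+-multiple r (a - 1) m))
    row≡ : (((b + m * + t + n * + s) - 1) - winding (a + m * + r) * + t) %ℕ s
         ≡ ((b - 1) - winding a * + t) %ℕ s
    row≡ = trans (cong (λ w → (((b + m * + t + n * + s) - 1) - w * + t) %ℕ s) winding≡)
          (trans (cong (_%ℕ s) (regroup b m n (winding a) (+ t) (+ s)))
                 (proj₁ (divMod-+-multiple s ((b - 1) - winding a * + t) n)))
      where
      regroup : ∀ b m n w t s → ((b + m * t + n * s) - 1) - (w + m) * t ≡ ((b - 1) - w * t) + n * s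
      regroup = solve-∀

  column-shift : ∀ a a′ → (a - 1) %ℕ r ≡ (a′ - 1) %ℕ r → a′ ≡ a + (winding a′ - winding a) * + r
  column-shift a a′ eq = begin
    a′                               ≡⟨ sym ([a-c]+c≡a a′ 1) ⟩
    (a′ - 1) + 1                     ≡⟨ cong (_+ 1) (x%d≡y%d⇒y≡x+[y/d-x/d]*d r (a - 1) (a′ - 1) eq) ⟩
    ((a - 1) + m * + r) + 1       ≡⟨ regroup a (m * + r) ⟩
    a + m * + r                      ∎
    where
    open ≡-Reasoning
    m = winding a′ - winding a
    regroup : ∀ a k → ((a - 1) + k) + 1 ≡ a + k
    regroup = solve-∀

  column≡⇒period : ∀ a b a′ b′ → proj₁ (pos a b) ≡ proj₁ (pos a′ b′) → ∃[ m ] a′ ≡ a + m * + r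
  column≡⇒period a b a′ b′ eq =
    winding a′ - winding a , column-shift a a′ (FinP.fromℕ<-injective _ _ _ _ eq)

  pos≡⇒periods : ∀ a b a′ b′ → pos a b ≡ pos a′ b′ →
                 ∃[ m ] ∃[ n ] a′ ≡ a + m * + r × b′ ≡ b + m * + t + n * + s
  pos≡⇒periods a b a′ b′ eq =
    m , n , column-shift a a′ (FinP.fromℕ<-injective _ _ _ _ (cong proj₁ eq)) , (begin
    b′                                               ≡⟨ unwind b′ (winding a′) (+ t) ⟩
    (B′ + winding a′ * + t) + 1                     ≡⟨ cong (λ z → (z + winding a′ * + t) + 1) B′≡ ⟩
    ((B + n * + s) + winding a′ * + t) + 1          ≡⟨ regroup b (winding a) (winding a′) n (+ t) (+ s) ⟩
    b + m * + t + n * + s                            ∎)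
    where
    open ≡-Reasoning
    m = winding a′ - winding a
    B = (b - 1) - winding a * + t
    B′ = (b′ - 1) - winding a′ * + t
    n = B′ /ℕ s - B /ℕ s
    B′≡ : B′ ≡ B + n * + s
    B′≡ = x%d≡y%d⇒y≡x+[y/d-x/d]*d s B B′ (FinP.fromℕ<-injective _ _ _ _ (cong proj₂ eq))
    unwind : ∀ b w t → b ≡ (((b - 1) - w * t) + w * t) + 1
    unwind = solve-∀
    regroup : ∀ b w w′ n t s → ((((b - 1) - w * t) + n * s) + w′ * t) + 1 ≡ b + (w′ - w) * t + n * s
    regroup = solve-∀

  pos-translate : ∀ a b a′ b′ → pos a b ≡ pos a′ b′ →
                  ∀ p q → pos (a + p) (b + q) ≡ pos (a′ + p) (b′ + q)
  pos-translate a b a′ b′ eq p q = begin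
    pos (a + p) (b + q)                                  ≡⟨ sym (pos-periodic (a + p) (b + q) m n) ⟩
    pos ((a + p) + m * + r) ((b + q) + m * + t + n * + s)  ≡⟨ cong₂ pos column≡ row≡ ⟩
    pos (a′ + p) (b′ + q)                                ∎
    where
    open ≡-Reasoning
    periods = pos≡⇒periods a b a′ b′ eq
    m = proj₁ periods
    n = proj₁ (proj₂ periods)
    swap : ∀ a k p → (a + p) + k ≡ (a + k) + p
    swap = solve-∀
    swap₃ : ∀ b k l q → (b + q) + k + l ≡ (b + k + l) + q
    swap₃ = solve-∀
    column≡ : (a + p) + m * + r ≡ a′ + p
    column≡ = trans (swap a (m * + r) p) (cong (_+ p) (sym (proj₁ (proj₂ (proj₂ periods)))))
    row≡ : (b + q) + m * + t + n * + s ≡ b′ + q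
    row≡ = trans (swap₃ b (m * + t) (n * + s) q) (cong (_+ q) (sym (proj₂ (proj₂ (proj₂ periods)))))

  pos-translateʳ : ∀ a b a′ b′ → pos a b ≡ pos a′ b′ → ∀ q → pos a (b + q) ≡ pos a′ (b′ + q)
  pos-translateʳ a b a′ b′ eq q =
    subst₂ (λ x x′ → pos x (b + q) ≡ pos x′ (b′ + q)) (ℤP.+-identityʳ a) (ℤP.+-identityʳ a′)
           (pos-translate a b a′ b′ eq 0 q)

  pos-translateˡ : ∀ a b a′ b′ → pos a b ≡ pos a′ b′ → ∀ p → pos (a + p) b ≡ pos (a′ + p) b′
  pos-translateˡ a b a′ b′ eq p =
    subst₂ (λ y y′ → pos (a + p) y ≡ pos (a′ + p) y′) (ℤP.+-identityʳ b) (ℤP.+-identityʳ b′)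
           (pos-translate a b a′ b′ eq p 0)

  Nbr-resp : ∀ a b a′ b′ {w} → pos a b ≡ pos a′ b′ → Nbr a b w → Nbr a′ b′ w
  Nbr-resp a b a′ b′ eq =
    Sum.map (along (pos-translateʳ a b a′ b′ eq 1)) (Sum.map (along (pos-translateʳ a b a′ b′ eq -1))
      (Sum.map (along (pos-translateˡ a b a′ b′ eq -1)) (Sum.map (along (pos-translate a b a′ b′ eq -1 1))
        (Sum.map (along (pos-translateˡ a b a′ b′ eq 1)) (along (pos-translate a b a′ b′ eq 1 -1))))))
    where
    along : ∀ {w v v′} → v ≡ v′ → w ≡ v → w ≡ v′
    along v≡v′ w≡v = trans w≡v v≡v′

  adj⇒Nbr : ∀ a b {w} → Adj (pos a b) w → Nbr a b w
  adj⇒Nbr a b (a′ , b′ , eq , nbr) = Nbr-resp a′ b′ a b eq nbr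

  Adj-sym : ∀ {u w} → Adj u w → Adj w u
  Adj-sym (a , b , refl , inj₁ refl) =
    a , b + 1 , refl , inj₂ (inj₁ (cong (pos a) (sym ([a+c]-c≡a b 1))))
  Adj-sym (a , b , refl , inj₂ (inj₁ refl)) =
    a , b - 1 , refl , inj₁ (cong (pos a) (sym ([a-c]+c≡a b 1)))
  Adj-sym (a , b , refl , inj₂ (inj₂ (inj₁ refl))) =
    a - 1 , b , refl , inj₂ (inj₂ (inj₂ (inj₂ (inj₁ (cong (λ x → pos x b) (sym ([a-c]+c≡a a 1)))))))
  Adj-sym (a , b , refl , inj₂ (inj₂ (inj₂ (inj₁ refl)))) =
    a - 1 , b + 1 , refl ,
    inj₂ (inj₂ (inj₂ (inj₂ (inj₂ (cong₂ pos (sym ([a-c]+c≡a a 1)) (sym ([a+c]-c≡a b 1)))))))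
  Adj-sym (a , b , refl , inj₂ (inj₂ (inj₂ (inj₂ (inj₁ refl))))) =
    a + 1 , b , refl , inj₂ (inj₂ (inj₁ (cong (λ x → pos x b) (sym ([a+c]-c≡a a 1)))))
  Adj-sym (a , b , refl , inj₂ (inj₂ (inj₂ (inj₂ (inj₂ refl))))) =
    a + 1 , b - 1 , refl ,
    inj₂ (inj₂ (inj₂ (inj₁ (cong₂ pos (sym ([a+c]-c≡a a 1)) (sym ([a-c]+c≡a b 1))))))

  columns-apart : ∀ a b a′ b′ k → 0 < k → k < r → a′ ≡ a + + k →
                  proj₁ (pos a b) ≢ proj₁ (pos a′ b′)
  columns-apart a b a′ b′ k 0<k k<r a′≡a+k eq with column≡⇒period a b a′ b′ eq
  ... | m , a′≡a+mr = ℕP.<⇒≢ 0<k (sym (ℤP.+-injective (begin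
    + k        ≡⟨ k≡mr ⟩
    m * + r    ≡⟨ cong (_* + r) (small-multiple≡0 r m k<r k≡mr) ⟩
    0ℤ         ∎)))
    where
    open ≡-Reasoning
    k≡mr : + k ≡ m * + r
    k≡mr = ∙-cancelˡ a (+ k) (m * + r) (trans (sym a′≡a+k) a′≡a+mr)

  ¬Adj-two-columns-apart : 3 < r → ∀ a b a′ b′ → a′ ≡ a + 2 → ¬ Adj (pos a b) (pos a′ b′)
  ¬Adj-two-columns-apart 3<r a b a′ b′ a′≡a+2 adj = nonadjacent (adj⇒Nbr a b adj)
    where
    2<r = ℕP.<-trans (ℕP.n<1+n 2) 3<r
    1<r = ℕP.<-trans (ℕP.n<1+n 1) 2<r
    apart : ∀ c d k → 0 < k → k < r → a′ ≡ c + + k → pos a′ b′ ≡ pos c d → ⊥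
    apart c d k 0<k k<r a′≡c+k q = columns-apart c d a′ b′ k 0<k k<r a′≡c+k (sym (cong proj₁ q))
    left-of : ∀ a → a + 2 ≡ (a - 1) + 3
    left-of = solve-∀
    right-of : ∀ a → a + 2 ≡ (a + 1) + 1
    right-of = solve-∀
    nonadjacent : ¬ Nbr a b (pos a′ b′)
    nonadjacent (inj₁ q)                             = apart a (b + 1) 2 (s≤s z≤n) 2<r a′≡a+2 q
    nonadjacent (inj₂ (inj₁ q))                      = apart a (b - 1) 2 (s≤s z≤n) 2<r a′≡a+2 q
    nonadjacent (inj₂ (inj₂ (inj₁ q)))               = apart (a - 1) b 3 (s≤s z≤n) 3<r (trans a′≡a+2 (left-of a)) q
    nonadjacent (inj₂ (inj₂ (inj₂ (inj₁ q))))        = apart (a - 1) (b + 1) 3 (s≤s z≤n) 3<r (trans a′≡a+2 (left-of a)) q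
    nonadjacent (inj₂ (inj₂ (inj₂ (inj₂ (inj₁ q))))) = apart (a + 1) b 1 (s≤s z≤n) 1<r (trans a′≡a+2 (right-of a)) q
    nonadjacent (inj₂ (inj₂ (inj₂ (inj₂ (inj₂ q))))) = apart (a + 1) (b - 1) 1 (s≤s z≤n) 1<r (trans a′≡a+2 (right-of a)) q

  module _ (F : Frame) where
    open Frame F

    at : ℤ → ℤ → Vtx r s
    at x y = pos (col x) (row y)

    VerticalNbr : ℤ → ℤ → Vtx r s → Set
    VerticalNbr x y w = w ≡ at x (y + 1) ⊎ w ≡ at x (y - 1)

    HorizontalNbr : ℤ → Vtx r s → Set
    HorizontalNbr x w = Σ Side λ σ → Σ ℤ λ y → w ≡ at (beside σ x) y

    at-+ : ∀ x y p q → at (x + p) (y + q) ≡ pos (col x + p) (row y + q)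
    at-+ x y p q = cong₂ pos (col-+ x p) (row-+ y q)

    at-+ʳ : ∀ x y q → at x (y + q) ≡ pos (col x) (row y + q)
    at-+ʳ x y q = cong (pos (col x)) (row-+ y q)

    at-+ˡ : ∀ x y p → at (x + p) y ≡ pos (col x + p) (row y)
    at-+ˡ x y p = cong (λ c → pos c (row y)) (col-+ x p)

    private
      two-apart : ∀ x → col (x + 1) ≡ col (x - 1) + 2
      two-apart x = begin
        col (x + 1)            ≡⟨ col-+ x 1 ⟩
        col x + 1              ≡⟨ regroup (col x) ⟩
        (col x - 1) + 2      ≡⟨ cong (_+ 2) (sym (col-+ x -1)) ⟩
        col (x - 1) + 2      ∎
        where
        open ≡-Reasoning
        regroup : ∀ c → c + 1 ≡ (c - 1) + 2
        regroup = solve-∀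

    Adj-at⇒ : ∀ x y {w} → Adj (at x y) w → VerticalNbr x y w ⊎ HorizontalNbr x w
    Adj-at⇒ x y adj = classify (adj⇒Nbr (col x) (row y) adj)
      where
      classify : ∀ {w} → Nbr (col x) (row y) w → VerticalNbr x y w ⊎ HorizontalNbr x w
      classify (inj₁ q)                             = inj₁ (inj₁ (trans q (sym (at-+ʳ x y 1))))
      classify (inj₂ (inj₁ q))                      = inj₁ (inj₂ (trans q (sym (at-+ʳ x y -1))))
      classify (inj₂ (inj₂ (inj₁ q)))               = inj₂ (left , y , trans q (sym (at-+ˡ x y -1)))
      classify (inj₂ (inj₂ (inj₂ (inj₁ q))))        = inj₂ (left , y + 1 , trans q (sym (at-+ x y -1 1)))
      classify (inj₂ (inj₂ (inj₂ (inj₂ (inj₁ q))))) = inj₂ (right , y , trans q (sym (at-+ˡ x y 1)))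
      classify (inj₂ (inj₂ (inj₂ (inj₂ (inj₂ q))))) = inj₂ (right , y - 1 , trans q (sym (at-+ x y 1 -1)))

    vertNbr-at⇒ : ∀ x y {w} → VertNbr (at x y) w → VerticalNbr x y w
    vertNbr-at⇒ x y (i , j , eq , inj₁ q) =
      inj₁ (trans q (trans (pos-translateʳ i j (col x) (row y) eq 1) (sym (at-+ʳ x y 1))))
    vertNbr-at⇒ x y (i , j , eq , inj₂ q) =
      inj₂ (trans q (trans (pos-translateʳ i j (col x) (row y) eq -1) (sym (at-+ʳ x y -1))))

    adj-left : ∀ x y → Adj (at x y) (at (x - 1) y)
    adj-left x y = col x , row y , refl , inj₂ (inj₂ (inj₁ (at-+ˡ x y -1)))

    adj-right : ∀ x y → Adj (at x y) (at (x + 1) y)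
    adj-right x y = col x , row y , refl , inj₂ (inj₂ (inj₂ (inj₂ (inj₁ (at-+ˡ x y 1)))))

    adj-right-down : ∀ x y → Adj (at x y) (at (x + 1) (y - 1))
    adj-right-down x y = col x , row y , refl , inj₂ (inj₂ (inj₂ (inj₂ (inj₂ (at-+ x y 1 -1)))))

    horizontal-column-apart : 1 < r → ∀ x y {w} → HorizontalNbr x w → proj₁ (at x y) ≢ proj₁ w
    horizontal-column-apart 1<r x y (left , y′ , refl) eq =
      columns-apart (col (x - 1)) (row y′) (col x) (row y) 1 (s≤s z≤n) 1<r
        (trans (cong col (sym ([a-c]+c≡a x 1))) (col-+ (x - 1) 1)) (sym eq)
    horizontal-column-apart 1<r x y (right , y′ , refl) =
      columns-apart (col x) (row y) (col (x + 1)) (row y′) 1 (s≤s z≤n) 1<r (col-+ x 1)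

    adjacent-horizontal-share-column : 3 < r → ∀ x {w w′} → HorizontalNbr x w → HorizontalNbr x w′ →
                                       Adj w w′ → proj₁ w ≡ proj₁ w′
    adjacent-horizontal-share-column _ _ (left , _ , refl) (left , _ , refl) _ = refl
    adjacent-horizontal-share-column _ _ (right , _ , refl) (right , _ , refl) _ = refl
    adjacent-horizontal-share-column 3<r x (left , y , refl) (right , y′ , refl) adj =
      ⊥-elim (¬Adj-two-columns-apart 3<r (col (x - 1)) (row y) (col (x + 1)) (row y′) (two-apart x) adj)
    adjacent-horizontal-share-column 3<r x (right , y , refl) (left , y′ , refl) adj =
      ⊥-elim (¬Adj-two-columns-apart 3<r (col (x - 1)) (row y′) (col (x + 1)) (row y) (two-apart x)
                                     (Adj-sym adj))


module BoundaryPropagation (r s t : ℕ) {{_ : NonZero r}} {{_ : NonZero s}} (3<r : 3 < r)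
                  (L : Vtx r s → List ℕ) (size5 : ∀ v → Size5 (L v))
                  (crit1 : Torus.CritI r s t L) (crit2 : Torus.CritII r s t L)
                  (crit3 : Torus.CritIII r s t L) (crit4 : Torus.CritIV r s t L) where
  open Torus r s t
  open Geometry r s t

  1<r : 1 < r
  1<r = ℕP.<-trans (ℕP.n<1+n 1) (ℕP.<-trans (ℕP.n<1+n 2) 3<r)

  ℓ : Frame → ℤ → ℤ → List ℕ
  ℓ F x y = L (at F x y)

  Gap : List ℕ → List ℕ → Vtx r s → Set
  Gap M₁ M₂ v = Isolated L v × ¬ (L v ≈L M₁) × ¬ (L v ≈L M₂)

  Upper Lower : Frame → List ℕ → Set
  Upper F M = ℓ F 0 2 ≈L M × ℓ F 0 1 ≈L M
  Lower F M = ℓ F 0 0 ≈L M × ℓ F 0 -1 ≈L M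

  Boundary : Frame → List ℕ → List ℕ → Set
  Boundary F M₁ M₂ = Upper F M₁ × Lower F M₂

  isolated-if-vertical-neighbours-differ : ∀ F → ¬ (ℓ F 0 1 ≈L ℓ F 0 0) →
    ¬ (ℓ F 0 -1 ≈L ℓ F 0 0) → Isolated L (at F 0 0)
  isolated-if-vertical-neighbours-differ F up≉ down≉ w u~w Lw≈Lu =
    Sum.[ (λ w↕u → vertical-differs w↕u Lw≈Lu) , horizontal ]′ (Adj-at⇒ F 0 0 u~w)
    where
    u = at F 0 0
    vertical-differs : ∀ {v} → VerticalNbr F 0 0 v → ¬ (L v ≈L L u)
    vertical-differs (inj₁ refl) = up≉
    vertical-differs (inj₂ refl) = down≉
    triangle : ∀ {w′} → Adj u w′ → Adj w w′ → L w′ ≈L L u → HorizontalNbr F 0 w → ⊥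
    triangle u~w′ w~w′ Lw′≈Lu w↔u = Sum.[ (λ w′↕u → vertical-differs w′↕u Lw′≈Lu) , (λ w′↔u →
        let x , u↕x , Lx≈Lu = crit4 u w _ u~w u~w′ w~w′ Lw≈Lu Lw′≈Lu
                                (adjacent-horizontal-share-column F 3<r 0 w↔u w′↔u w~w′)
        in vertical-differs (vertNbr-at⇒ F 0 0 u↕x) Lx≈Lu) ]′ (Adj-at⇒ F 0 0 u~w′)
    horizontal : HorizontalNbr F 0 w → ⊥
    horizontal w↔u =
      let w′ , u~w′ , w~w′ , Lw′≈Lu =
            crit3 u w u~w (horizontal-column-apart F 1<r 0 0 w↔u) (≈-sym Lw≈Lu)
      in triangle u~w′ w~w′ Lw′≈Lu w↔u

  ¬Isolated⇒vertical≈ : ∀ F → ¬ Isolated L (at F 0 0) →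
                        ℓ F 0 1 ≈L ℓ F 0 0 ⊎ ℓ F 0 -1 ≈L ℓ F 0 0
  ¬Isolated⇒vertical≈ F ¬isolated with ℓ F 0 1 ≈? ℓ F 0 0 | ℓ F 0 -1 ≈? ℓ F 0 0
  ... | yes up≈ | _         = inj₁ up≈
  ... | no  _   | yes down≈ = inj₂ down≈
  ... | no  up≉ | no  down≉ = contradiction (isolated-if-vertical-neighbours-differ F up≉ down≉) ¬isolated

  ¬Isolated⇒up≈ : ∀ F {M} → ¬ Isolated L (at F 0 0) → ℓ F 0 0 ≈L M →
                  ¬ (ℓ F 0 -1 ≈L M) → ℓ F 0 1 ≈L M
  ¬Isolated⇒up≈ F ¬isolated ℓ₀≈M down≉M = Sum.[ (λ up≈ → ≈-trans up≈ ℓ₀≈M) ,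
    (λ down≈ → contradiction (≈-trans down≈ ℓ₀≈M) down≉M) ]′ (¬Isolated⇒vertical≈ F ¬isolated)

  ¬Isolated⇒down≈ : ∀ F {M} → ¬ Isolated L (at F 0 0) → ℓ F 0 0 ≈L M →
                    ¬ (ℓ F 0 1 ≈L M) → ℓ F 0 -1 ≈L M
  ¬Isolated⇒down≈ F ¬isolated ℓ₀≈M up≉M = Sum.[ (λ up≈ → contradiction (≈-trans up≈ ℓ₀≈M) up≉M) ,
    (λ down≈ → ≈-trans down≈ ℓ₀≈M) ]′ (¬Isolated⇒vertical≈ F ¬isolated)

  left-neighbours-agree⇒≈ : ∀ F x y {M} → ℓ F (x - 1) y ≈L M → ℓ F (x - 1) (y + 1) ≈L M →
                            ℓ F x y ≈L M
  left-neighbours-agree⇒≈ F x y ℓ₁≈M ℓ₂≈M = ≈-trans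
    (Size5-⊆⇒≈ (size5 _) (size5 _) (⊆-∪-≈⇒⊆ left-lists ≈-refl (≈-trans ℓ₂≈M (≈-sym ℓ₁≈M)))) ℓ₁≈M
    where
    open Frame F
    left-lists : ℓ F x y ⊆ ℓ F (x - 1) y ∪ ℓ F (x - 1) (y + 1)
    left-lists = subst₂ (λ B C → ℓ F x y ⊆ B ∪ C)
                        (cong L (sym (at-+ˡ F x y -1))) (cong L (sym (at-+ F x y -1 1)))
                        (proj₁ (proj₂ crit1 (col x) (row y)))

  NextColumn : Frame → List ℕ → List ℕ → Set
  NextColumn F M₁ M₂ =
      Boundary (shift F 1 0) M₁ M₂
    ⊎ Boundary (shift F 1 -1) M₁ M₂
    ⊎ Upper (shift F 1 0) M₁ × Lower (shift F 1 -1) M₂ × Gap M₁ M₂ (at F 1 0)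

  boundary⇒next-column : ∀ F {M₁ M₂} → ¬ (M₁ ≈L M₂) → Boundary F M₁ M₂ → NextColumn F M₁ M₂
  boundary⇒next-column F {M₁} {M₂} M₁≉M₂ ((ℓ₀₂ , ℓ₀₁) , (ℓ₀₀ , ℓ₀₋₁)) =
    next-column (ℓ F 1 0 ≈? M₁) (ℓ F 1 0 ≈? M₂)
    where
    ℓ₁₁ : ℓ F 1 1 ≈L M₁
    ℓ₁₁ = left-neighbours-agree⇒≈ F 1 1 ℓ₀₁ ℓ₀₂
    ℓ₁₋₁ : ℓ F 1 -1 ≈L M₂
    ℓ₁₋₁ = left-neighbours-agree⇒≈ F 1 -1 ℓ₀₋₁ ℓ₀₀
    ℓ₁₂ : ¬ (ℓ F 1 0 ≈L M₁) → ℓ F 1 2 ≈L M₁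
    ℓ₁₂ ℓ₁₀≉M₁ = ¬Isolated⇒up≈ (shift F 1 1)
      (λ isolated → isolated _ (adj-left (shift F 1 1) 0 0) (≈-trans ℓ₀₁ (≈-sym ℓ₁₁))) ℓ₁₁ ℓ₁₀≉M₁
    ℓ₁₋₂ : ¬ (ℓ F 1 0 ≈L M₂) → ℓ F 1 -2 ≈L M₂
    ℓ₁₋₂ ℓ₁₀≉M₂ = ¬Isolated⇒down≈ (shift F 1 -1)
      (λ isolated → isolated _ (adj-left (shift F 1 -1) 0 0) (≈-trans ℓ₀₋₁ (≈-sym ℓ₁₋₁))) ℓ₁₋₁ ℓ₁₀≉M₂
    next-column : Dec (ℓ F 1 0 ≈L M₁) → Dec (ℓ F 1 0 ≈L M₂) → NextColumn F M₁ M₂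
    next-column (yes ℓ₁₀≈M₁) _ =
      inj₂ (inj₁ ((ℓ₁₁ , ℓ₁₀≈M₁) , (ℓ₁₋₁ , ℓ₁₋₂ (λ ℓ₁₀≈M₂ → M₁≉M₂ (≈-trans (≈-sym ℓ₁₀≈M₁) ℓ₁₀≈M₂)))))
    next-column (no ℓ₁₀≉M₁) (yes ℓ₁₀≈M₂) = inj₁ ((ℓ₁₂ ℓ₁₀≉M₁ , ℓ₁₁) , (ℓ₁₀≈M₂ , ℓ₁₋₁))
    next-column (no ℓ₁₀≉M₁) (no ℓ₁₀≉M₂) = inj₂ (inj₂ ((ℓ₁₂ ℓ₁₀≉M₁ , ℓ₁₁) , (ℓ₁₋₁ , ℓ₁₋₂ ℓ₁₀≉M₂) ,
      isolated-if-vertical-neighbours-differ (shift F 1 0)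
        (λ ℓ₁₁≈ℓ₁₀ → ℓ₁₀≉M₁ (≈-trans (≈-sym ℓ₁₁≈ℓ₁₀) ℓ₁₁))
        (λ ℓ₁₋₁≈ℓ₁₀ → ℓ₁₀≉M₂ (≈-trans (≈-sym ℓ₁₋₁≈ℓ₁₀) ℓ₁₋₁)) ,
      ℓ₁₀≉M₁ , ℓ₁₀≉M₂))

  RightCases : List ℕ → List ℕ → List ℕ → List ℕ → List ℕ → Set
  RightCases A A⁻ B B⁻² B⁻ =
      (A ≈L B × A⁻ ≈L B⁻²)
    ⊎ (A⁻ ≈L B⁻² × B⁻² ≈L B⁻ × ¬ (A ≈L B))
    ⊎ (¬ (A⁻ ≈L B⁻²) × A ≈L B⁻ × B⁻ ≈L B)

  critII-right : ∀ F x y → ¬ (ℓ F x y ≈L ℓ F x (y - 1)) →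
    RightCases (ℓ F x y) (ℓ F x (y - 1)) (ℓ F (x + 1) y) (ℓ F (x + 1) (y - 2)) (ℓ F (x + 1) (y - 1))
  critII-right F x y change = transport
    (cong L (sym (at-+ʳ F x y -1))) (cong L (sym (at-+ˡ F x y 1)))
    (cong L (sym (at-+ F x y 1 -2))) (cong L (sym (at-+ F x y 1 -1)))
    (proj₂ (crit2 (col x) (row y) (change ∘ subst (ℓ F x y ≈L_) (cong L (sym (at-+ʳ F x y -1))))))
    where
    open Frame F
    transport : ∀ {A A⁻ A⁻′ B B′ B⁻² B⁻²′ B⁻ B⁻′} → A⁻ ≡ A⁻′ → B ≡ B′ → B⁻² ≡ B⁻²′ → B⁻ ≡ B⁻′ →
                RightCases A A⁻ B B⁻² B⁻ → RightCases A A⁻′ B′ B⁻²′ B⁻′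
    transport refl refl refl refl cases = cases

  gap⇒shifted-boundary : ∀ F {M₁ M₂} → ℓ F 0 1 ≈L M₁ → ℓ F 0 -1 ≈L M₂ → Gap M₁ M₂ (at F 0 0) →
                         Boundary (shift F 1 -1) M₁ M₂
  gap⇒shifted-boundary F {M₁} {M₂} ℓ₀₁≈M₁ ℓ₀₋₁≈M₂ (isolated , ℓ₀₀≉M₁ , ℓ₀₀≉M₂) =
    upper (critII-right F 0 1 change₁) , lower (critII-right F 0 0 change₀)
    where
    ¬ℓ₀₀≈ℓ₁₀ : ¬ (ℓ F 0 0 ≈L ℓ F 1 0)
    ¬ℓ₀₀≈ℓ₁₀ e = isolated _ (adj-right F 0 0) (≈-sym e)
    ¬ℓ₀₀≈ℓ₁₋₁ : ¬ (ℓ F 0 0 ≈L ℓ F 1 -1)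
    ¬ℓ₀₀≈ℓ₁₋₁ e = isolated _ (adj-right-down F 0 0) (≈-sym e)
    change₁ : ¬ (ℓ F 0 1 ≈L ℓ F 0 0)
    change₁ e = ℓ₀₀≉M₁ (≈-trans (≈-sym e) ℓ₀₁≈M₁)
    change₀ : ¬ (ℓ F 0 0 ≈L ℓ F 0 -1)
    change₀ e = ℓ₀₀≉M₂ (≈-trans e ℓ₀₋₁≈M₂)
    upper : RightCases (ℓ F 0 1) (ℓ F 0 0) (ℓ F 1 1) (ℓ F 1 -1) (ℓ F 1 0) →
            Upper (shift F 1 -1) M₁
    upper (inj₁ (_ , e))                       = ⊥-elim (¬ℓ₀₀≈ℓ₁₋₁ e)
    upper (inj₂ (inj₁ (e , _)))                = ⊥-elim (¬ℓ₀₀≈ℓ₁₋₁ e)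
    upper (inj₂ (inj₂ (_ , ℓ₀₁≈ℓ₁₀ , ℓ₁₀≈ℓ₁₁))) =
      ≈-trans (≈-sym ℓ₁₀≈ℓ₁₁) (≈-trans (≈-sym ℓ₀₁≈ℓ₁₀) ℓ₀₁≈M₁) , ≈-trans (≈-sym ℓ₀₁≈ℓ₁₀) ℓ₀₁≈M₁
    lower : RightCases (ℓ F 0 0) (ℓ F 0 -1) (ℓ F 1 0) (ℓ F 1 -2) (ℓ F 1 -1) →
            Lower (shift F 1 -1) M₂
    lower (inj₁ (e , _))                        = ⊥-elim (¬ℓ₀₀≈ℓ₁₀ e)
    lower (inj₂ (inj₁ (ℓ₀₋₁≈ℓ₁₋₂ , ℓ₁₋₂≈ℓ₁₋₁ , _))) =
      ≈-trans (≈-sym ℓ₁₋₂≈ℓ₁₋₁) (≈-trans (≈-sym ℓ₀₋₁≈ℓ₁₋₂) ℓ₀₋₁≈M₂) , ≈-trans (≈-sym ℓ₀₋₁≈ℓ₁₋₂) ℓ₀₋₁≈M₂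
    lower (inj₂ (inj₂ (_ , e , _)))             = ⊥-elim (¬ℓ₀₀≈ℓ₁₋₁ e)

  module _ (i j : ℤ) where
    F₀ : Frame
    F₀ = frame i j

    M₁ M₂ : List ℕ
    M₁ = L₁ L i j
    M₂ = L₂ L i j

    at-origin : ∀ y → at F₀ 0 y ≡ pos i (j + y)
    at-origin y = cong (λ a → pos a (j + y)) (ℤP.+-identityʳ i)

    origin-≈ : ∀ y {M} → ℓ F₀ 0 y ≈L M → Lz L i (j + y) ≈L M
    origin-≈ y = subst (λ v → L v ≈L _) (at-origin y)

    lowered : ∀ c a k {M} → Lz L (i + c) (j + (- a + k)) ≈L M → Lz L (i + c) ((j + k) - a) ≈L M
    lowered c a k = subst (λ y → Lz L (i + c) y ≈L _) (regroup j a k)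
      where
      regroup : ∀ j a k → j + (- a + k) ≡ (j + k) - a
      regroup = solve-∀

    lowered₀ : ∀ c a {M} → Lz L (i + c) (j + (- a + 0)) ≈L M → Lz L (i + c) (j - a) ≈L M
    lowered₀ c a = subst (λ y → Lz L (i + c) y ≈L _) (cong (λ z → j + z) (ℤP.+-identityʳ (- a)))

    Upper⇒Top : ∀ a b → Upper F₀ M₁ → Upper (shift F₀ 1 (- a)) M₁ →
          Upper (shift F₀ 2 (- b)) M₁ → Top L i j a b
    Upper⇒Top a b (ℓ₀₂ , _) (ℓ₁₂ , ℓ₁₁) (ℓ₂₂ , ℓ₂₁) =
      (origin-≈ 2 ℓ₀₂ , lowered 1 a 2 ℓ₁₂ , lowered 2 b 2 ℓ₂₂) ,
      (≈-refl , lowered 1 a 1 ℓ₁₁ , lowered 2 b 1 ℓ₂₁)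

    Lower⇒Bot : ∀ a b → Lower F₀ M₂ → Lower (shift F₀ 1 (- a)) M₂ →
             Lower (shift F₀ 2 (- b)) M₂ → Bot L i j a b
    Lower⇒Bot a b (_ , ℓ₀₋₁) (ℓ₁₀ , ℓ₁₋₁) (ℓ₂₀ , ℓ₂₋₁) =
      (≈-refl , lowered₀ 1 a ℓ₁₀ , lowered₀ 2 b ℓ₂₀) ,
      (origin-≈ -1 ℓ₀₋₁ , lowered 1 a -1 ℓ₁₋₁ , lowered 2 b -1 ℓ₂₋₁)

    origin-boundary : ¬ (M₁ ≈L M₂) → ¬ Isolated L (pos i (j + 1)) → ¬ Isolated L (pos i j) →
                      Boundary F₀ M₁ M₂
    origin-boundary L₁≉L₂ ¬isolated₁ ¬isolated₀ = (ℓ₀₂ , ℓ₀₁) , (ℓ₀₀ , ℓ₀₋₁)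
      where
      at-origin₀ : at F₀ 0 0 ≡ pos i j
      at-origin₀ = trans (at-origin 0) (cong (pos i) (ℤP.+-identityʳ j))
      ℓ₀₁ : ℓ F₀ 0 1 ≈L M₁
      ℓ₀₁ = ≈-reflexive (cong L (at-origin 1))
      ℓ₀₀ : ℓ F₀ 0 0 ≈L M₂
      ℓ₀₀ = ≈-reflexive (cong L at-origin₀)
      ℓ₀₂ : ℓ F₀ 0 2 ≈L M₁
      ℓ₀₂ = ¬Isolated⇒up≈ (shift F₀ 0 1) (¬isolated₁ ∘ subst (Isolated L) (at-origin 1)) ℓ₀₁
              (λ ℓ₀₀≈L₁ → L₁≉L₂ (≈-trans (≈-sym ℓ₀₀≈L₁) ℓ₀₀))
      ℓ₀₋₁ : ℓ F₀ 0 -1 ≈L M₂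
      ℓ₀₋₁ = ¬Isolated⇒down≈ F₀ (¬isolated₀ ∘ subst (Isolated L) at-origin₀) ℓ₀₀
               (λ ℓ₀₁≈L₂ → L₁≉L₂ (≈-trans (≈-sym ℓ₀₁) ℓ₀₁≈L₂))

    gap-on-row-j : ∀ c → Gap M₁ M₂ (pos (i + c) (j + 0)) → IsoNew L i j (pos (i + c) j)
    gap-on-row-j c = subst (IsoNew L i j) (cong (pos (i + c)) (ℤP.+-identityʳ j))

    boundary⇒conclusion : ¬ (M₁ ≈L M₂) → Boundary F₀ M₁ M₂ → Conclusion L i j
    boundary⇒conclusion L₁≉L₂ column₀@(up₀ , low₀) = from-column₁ (boundary⇒next-column F₀ L₁≉L₂ column₀)
      where
      after-level : Boundary (shift F₀ 1 0) M₁ M₂ →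
                    NextColumn (shift F₀ 1 0) M₁ M₂ → Conclusion L i j
      after-level (up₁ , low₁) (inj₁ (up₂ , low₂)) =
        inj₁ (Upper⇒Top 0 0 up₀ up₁ up₂ , Lower⇒Bot 0 0 low₀ low₁ low₂)
      after-level (up₁ , low₁) (inj₂ (inj₁ (up₂ , low₂))) =
        inj₂ (inj₁ (Upper⇒Top 0 1 up₀ up₁ up₂ , Lower⇒Bot 0 1 low₀ low₁ low₂))
      after-level (up₁ , low₁) (inj₂ (inj₂ (up₂ , low₂ , gap))) =
        inj₂ (inj₂ (inj₂ (inj₂ (inj₁ (Upper⇒Top 0 0 up₀ up₁ up₂ , Lower⇒Bot 0 1 low₀ low₁ low₂ ,
                                     gap-on-row-j 2 gap)))))
      after-drop : Boundary (shift F₀ 1 -1) M₁ M₂ →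
                   NextColumn (shift F₀ 1 -1) M₁ M₂ → Conclusion L i j
      after-drop (up₁ , low₁) (inj₁ (up₂ , low₂)) =
        inj₂ (inj₂ (inj₁ (Upper⇒Top 1 1 up₀ up₁ up₂ , Lower⇒Bot 1 1 low₀ low₁ low₂)))
      after-drop (up₁ , low₁) (inj₂ (inj₁ (up₂ , low₂))) =
        inj₂ (inj₂ (inj₂ (inj₁ (Upper⇒Top 1 2 up₀ up₁ up₂ , Lower⇒Bot 1 2 low₀ low₁ low₂))))
      after-drop (up₁ , low₁) (inj₂ (inj₂ (up₂ , low₂ , gap))) =
        inj₂ (inj₂ (inj₂ (inj₂ (inj₂ (inj₁ (Upper⇒Top 1 1 up₀ up₁ up₂ , Lower⇒Bot 1 2 low₀ low₁ low₂ ,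
                                             gap))))))
      after-gap : Upper (shift F₀ 1 0) M₁ → Lower (shift F₀ 1 -1) M₂ →
                  Gap M₁ M₂ (at F₀ 1 0) →
                  Boundary (shift F₀ 2 -1) M₁ M₂ → Conclusion L i j
      after-gap up₁ low₁ gap (up₂ , low₂) =
        inj₂ (inj₂ (inj₂ (inj₂ (inj₂ (inj₂ (Upper⇒Top 0 1 up₀ up₁ up₂ , Lower⇒Bot 1 1 low₀ low₁ low₂ ,
                                             gap-on-row-j 1 gap))))))
      from-column₁ : NextColumn F₀ M₁ M₂ → Conclusion L i j
      from-column₁ (inj₁ column₁) =
        after-level column₁ (boundary⇒next-column (shift F₀ 1 0) L₁≉L₂ column₁)
      from-column₁ (inj₂ (inj₁ column₁)) =
        after-drop column₁ (boundary⇒next-column (shift F₀ 1 -1) L₁≉L₂ column₁)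
      from-column₁ (inj₂ (inj₂ (up₁ , low₁ , gap))) =
        after-gap up₁ low₁ gap (gap⇒shifted-boundary (shift F₀ 1 0) (proj₂ up₁) (proj₁ low₁) gap)

lemma16 : (r s t : ℕ) {{_ : NonZero r}} {{_ : NonZero s}} →
    4 ≤ r → 3 ≤ s → t < s →
    (L : Vtx r s → List ℕ) →
    (∀ v → Size5 (L v)) →
    Torus.Criteria r s t L →
    (i j : ℤ) →
    ¬ (Torus.Lz r s t L i (j + + 1) ≈L Torus.Lz r s t L i j) →
    ¬ Torus.Isolated r s t L (Torus.pos r s t i (j + + 1)) →
    ¬ Torus.Isolated r s t L (Torus.pos r s t i j) →
    Torus.Conclusion r s t L i j
lemma16 r s t 4≤r _ _ L size5 (crit1 , crit2 , crit3 , crit4) i j L₁≉L₂ ¬isolated₁ ¬isolated₀ =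
  boundary⇒conclusion i j L₁≉L₂ (origin-boundary i j L₁≉L₂ ¬isolated₁ ¬isolated₀)
  where open BoundaryPropagation r s t 4≤r L size5 crit1 crit2 crit3 crit4
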